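{- Let $\mathfrak{z}$ be the $\mathbb{Q}$-linear span of the $y_{s,0}$ ($s\in\mathbb{Z}_{>0}$). For $z\in\mathfrak{z}$ the map $\delta_z:\mathfrak{A}^1\to\mathfrak{A}^1$, $\delta_z(w)=z*w-zw$, is a derivation of $\mathfrak{A}^1$ (for concatenation) which preserves $\mathfrak{A}^0$. Moreover, $\delta_z$ extends to a derivation of $\mathfrak{A}$, namely the derivation determined on letters by $\delta_z(a)=0$ and $\delta_z(b_j)=(a+b_j)\tau_j(z)$ for $j=0,\dots,N-1$.
   Context: Fix an integer $N\ge1$; indices of letters are read modulo $N$. Let $\mathfrak{A}=\mathbb{Q}\langle a,b_0,\dots,b_{N-1}\rangle$ be the free noncommutative $\mathbb{Q}$-algebra (concatenation, unit = empty word $\mathbf{1}$); $y_{s,i}=a^{s-1}b_i$ ($s\ge1$); $\mathfrak{A}^1$ is the span of words not ending in $a$; $\mathfrak{A}^0\subset\mathfrak{A}^1$ is the span of $\mathbf{1}$ and the words neither beginning with $b_0$ nor ending with $a$. For an integer $j$, $\tau_j$ is the linear map on $\mathfrak{A}^1$ with $\tau_j(\mathbf{1})=\mathbf{1}$, $\tau_j(y_{s_1,i_1}\cdots y_{s_n,i_n})=y_{s_1,i_1+j}\cdots y_{s_n,i_n+j}$ (so $\tau_j(\sum_s c_sy_{s,0})=\sum_sc_sy_{s,j}$). The stuffle product $*$ on $\mathfrak{A}^1$ is bilinear with $\mathbf{1}*w=w*\mathbf{1}=w$ and $y_{s,j}\omega_1*y_{t,k}\omega_2=y_{s,j}\tau_j(\tau_{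 -j}(\omega_1)*y_{t,k}\omega_2)+y_{t,k}\tau_k(y_{s,j}\omega_1*\tau_{ -k}(\omega_2))+y_{s+t,j+k}\tau_{j+k}(\tau_{ -j}(\omega_1)*\tau_{ -k}(\omega_2))$ for words $\omega_1,\omega_2$. -}

module Defs where

open import Data.Nat as ℕ using (ℕ; zero; suc)
open import Data.Nat.DivMod using (_mod_)
open import Data.Fin as Fin using (Fin; toℕ)
open import Data.List using (List; []; _∷_; _++_; map; concatMap; length; replicate)
open import Data.Product using (_×_; _,_; proj₁; proj₂)
open import Data.Rational as ℚ using (ℚ; 0ℚ; 1ℚ)
open import Relation.Binary.PropositionalEquality using (_≡_; refl; cong)
open import Relation.Nullary using (yes; no; ¬_)
open import Relation.Binary.Definitions using (DecidableEquality)
open import Data.Unit using (⊤)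
import Data.List.Properties as LP
import Data.Product.Properties as PP
import Data.Nat.Properties as NP
import Data.Fin.Properties as FP

-- Finite formal Q-linear combinations of elements of a type W with
-- decidable equality; two combinations are equal (≈) iff all
-- coefficients agree.  This is the free Q-vector space on W.

module Lin {W : Set} (_≟_ : DecidableEquality W) where

  Comb : Set
  Comb = List (ℚ × W)

  coeff : Comb → W → ℚ
  coeff [] w = 0ℚ
  coeff ((c , v) ∷ p) w with v ≟ w
  ... | yes _ = c ℚ.+ coeff p w
  ... | no  _ = coeff p w

  infix 4 _≈_
  _≈_ : Comb → Comb → Set
  p ≈ q = ∀ w → coeff p w ≡ coeff q w

  ⟦_⟧ : W → Comb
  ⟦ w ⟧ = (1ℚ , w) ∷ []

  infixl 6 _⊕_
  _⊕_ : Comb → Comb → Comb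
  p ⊕ q = p ++ q

  infixl 7 _●_
  _●_ : ℚ → Comb → Comb
  c ● p = map (λ { (d , w) → (c ℚ.* d , w) }) p

  ⊖_ : Comb → Comb
  ⊖ p = (ℚ.- 1ℚ) ● p

linExt : {W W' : Set} → (W → List (ℚ × W')) → List (ℚ × W) → List (ℚ × W')
linExt f p = concatMap (λ { (c , w) → map (λ { (d , v) → (c ℚ.* d , v) }) (f w) }) p

bilinExt : {W₁ W₂ W' : Set} → (W₁ → W₂ → List (ℚ × W')) →
           List (ℚ × W₁) → List (ℚ × W₂) → List (ℚ × W')
bilinExt f p q = linExt (λ u → linExt (λ v → f u v) q) p

-- The algebra, for N = suc n letters b₀ … b_{N-1}; indices mod N.

module Alg (n : ℕ) where

  N : ℕ
  N = suc n

  Idx : Set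
  Idx = Fin N

  _⊞_ : Idx → Idx → Idx
  i ⊞ j = (toℕ i ℕ.+ toℕ j) mod N

  ⊟_ : Idx → Idx
  ⊟ j = (N ℕ.∸ toℕ j) mod N

  idx0 : Idx
  idx0 = Fin.zero

  data Letter : Set where
    a : Letter
    b : Idx → Letter

  _≟L_ : DecidableEquality Letter
  a ≟L a = yes refl
  a ≟L b _ = no (λ ())
  b _ ≟L a = no (λ ())
  b i ≟L b j with i FP.≟ j
  ... | yes refl = yes refl
  ... | no ne = no (λ { refl → ne refl })

  Word : Set
  Word = List Letter

  _≟W_ : DecidableEquality Word
  _≟W_ = LP.≡-dec _≟L_

  module A = Lin _≟W_

  𝔄 : Set
  𝔄 = A.Comb

  _·A_ : 𝔄 → 𝔄 → 𝔄
  _·A_ = bilinExt (λ u v → A.⟦ u ++ v ⟧)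

  -- y-letters: (k , i) stands for y_{k+1,i} = a^k b_i, i.e. s = k + 1 ≥ 1
  YLetter : Set
  YLetter = ℕ × Idx

  YWord : Set
  YWord = List YLetter

  _≟Y_ : DecidableEquality YWord
  _≟Y_ = LP.≡-dec (PP.≡-dec NP._≟_ FP._≟_)

  -- words in y-letters are exactly the words of 𝔄 not ending in a
  toWord : YWord → Word
  toWord = concatMap (λ { (k , i) → replicate k a ++ (b i ∷ []) })

  module A1 = Lin _≟Y_

  𝔄¹ : Set
  𝔄¹ = A1.Comb

  embed : 𝔄¹ → 𝔄
  embed = linExt (λ w → A.⟦ toWord w ⟧)

  _·_ : 𝔄¹ → 𝔄¹ → 𝔄¹
  _·_ = bilinExt (λ u v → A1.⟦ u ++ v ⟧)

  -- 𝔄⁰: words that are empty or do not begin with b₀ = y_{1,0}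
  IsA0Word : YWord → Set
  IsA0Word [] = ⊤
  IsA0Word ((k , i) ∷ _) = ¬ ((k ≡ 0) × (i ≡ idx0))

  InA0 : 𝔄¹ → Set
  InA0 p = ∀ w → ¬ IsA0Word w → A1.coeff p w ≡ 0ℚ

  τw : Idx → YWord → YWord
  τw j = map (λ { (k , i) → (k , i ⊞ j) })

  τ : Idx → 𝔄¹ → 𝔄¹
  τ j = linExt (λ w → A1.⟦ τw j w ⟧)

  ycons : YLetter → 𝔄¹ → 𝔄¹
  ycons x = map (λ { (c , w) → (c , x ∷ w) })

  -- stuffle on words, with a fuel argument bounding the recursion
  -- (fuel length u + length v always suffices; τ preserves length)
  stF : ℕ → YWord → YWord → 𝔄¹
  stF f [] v = A1.⟦ v ⟧
  stF f (x ∷ u) [] = A1.⟦ x ∷ u ⟧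
  stF zero (x ∷ u) (y ∷ v) = []
  stF (suc f) ((s , j) ∷ u) ((t , k) ∷ v) =
       ycons (s , j) (τ j (stF f (τw (⊟ j) u) ((t , k) ∷ v)))
    ++ ycons (t , k) (τ k (stF f ((s , j) ∷ u) (τw (⊟ k) v)))
    ++ ycons (suc (s ℕ.+ t) , j ⊞ k) (τ (j ⊞ k) (stF f (τw (⊟ j) u) (τw (⊟ k) v)))

  stuffleW : YWord → YWord → 𝔄¹
  stuffleW u v = stF (length u ℕ.+ length v) u v

  _*_ : 𝔄¹ → 𝔄¹ → 𝔄¹
  _*_ = bilinExt stuffleW

  -- 𝔷 = span of y_{s,0}: a list of pairs (c , k) stands for Σ c·y_{k+1,0}
  𝔷 : Set
  𝔷 = List (ℚ × ℕ)

  zElem : 𝔷 → 𝔄¹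
  zElem = map (λ { (c , k) → (c , (k , idx0) ∷ []) })

  δ : 𝔷 → 𝔄¹ → 𝔄¹
  δ z w = (zElem z * w) A1.⊕ (A1.⊖ (zElem z · w))

  Dletter : 𝔷 → Letter → 𝔄
  Dletter z a = []
  Dletter z (b j) = ((1ℚ , a ∷ []) ∷ (1ℚ , b j ∷ []) ∷ []) ·A embed (τ j (zElem z))

  Dword : 𝔷 → Word → 𝔄
  Dword z [] = []
  Dword z (l ∷ w) = (Dletter z l ·A A.⟦ w ⟧) ++ (A.⟦ l ∷ [] ⟧ ·A Dword z w)

  D : 𝔷 → 𝔄 → 𝔄
  D z = linExt (Dword z)

{-# OPTIONS --safe #-}
module Submission where

open import Defs
open import Data.Nat as ℕ using (ℕ; zero; suc; z≤n; s≤s; _%_)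
import Data.Nat.Properties as NP
open import Data.Nat.DivMod using (%-distribˡ-+; m%n%n≡m%n; m<n⇒m%n≡m; m%n<n; n%n≡0)
open import Data.Rational as ℚ using (ℚ; 0ℚ; 1ℚ)
import Data.Rational.Properties as QP
open import Data.Rational.Solver using (module +-*-Solver)
open +-*-Solver using (solve; _:+_; _:*_; _:=_; :-_; con)
open import Data.Product using (_×_; _,_; proj₁; proj₂)
open import Data.Sum using (_⊎_; inj₁; inj₂)
open import Data.Empty using (⊥-elim)
open import Data.Unit using (tt)
open import Data.Fin using (toℕ)
import Data.Fin.Properties as FP
open import Data.List using (List; []; _∷_; _++_; map; length; replicate)
import Data.List.Properties as LP
open import Relation.Binary.PropositionalEquality
open import Relation.Nullary using (yes; no; ¬_; Dec)
open import Relation.Binary.Definitions using (DecidableEquality)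
open ≡-Reasoning

-- A formal combination is determined by its pairings lsum p g = Σ c · g w against all
-- functions g on words, and every map involved is a (bi)linear extension of a map on words,
-- so each identity reduces to a computation of pairings on single words.  For a generator
-- y_{s,0} of 𝔷, unfolding the stuffle once and using that δ commutes with the shifts τ_j gives
--   δ(y_{t,l} ω) = y_{t,l} y_{s,l} ω + y_{t,l} δ(ω) + y_{s+t,l} ω,   δ(𝟏) = 0.
-- Induction on words then yields the Leibniz rule; it shows that every word in δ(w) begins with
-- the first letter y_{t,l} of w or with y_{s+t,l}, s + t ≥ 2, so 𝔄⁰ is preserved; and it matches
-- term by term the Leibniz expansion of D on a^{t-1} b_l ω, because D(b_l) = (a + b_l) a^{s-1} b_l.

lsum : {W : Set} → List (ℚ × W) → (W → ℚ) → ℚ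
lsum [] g = 0ℚ
lsum ((c , w) ∷ p) g = c ℚ.* g w ℚ.+ lsum p g

module _ {W : Set} where

  lsum-++ : ∀ (p q : List (ℚ × W)) g → lsum (p ++ q) g ≡ lsum p g ℚ.+ lsum q g
  lsum-++ [] q g = sym (QP.+-identityˡ _)
  lsum-++ ((c , w) ∷ p) q g =
    trans (cong (c ℚ.* g w ℚ.+_) (lsum-++ p q g)) (sym (QP.+-assoc (c ℚ.* g w) (lsum p g) (lsum q g)))

  -- The next two lemmas take any h acting like the map in question: _●_, linExt and
  -- zElem map with pattern lambdas, which are not definitionally equal to any written here.
  lsum-map-scale : ∀ c (h : ℚ × W → ℚ × W) → (∀ d w → h (d , w) ≡ (c ℚ.* d , w)) →
                   ∀ p g → lsum (map h p) g ≡ c ℚ.* lsum p g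
  lsum-map-scale c h h-scale [] g = sym (QP.*-zeroʳ c)
  lsum-map-scale c h h-scale ((d , w) ∷ p) g rewrite h-scale d w =
    trans (cong (c ℚ.* d ℚ.* g w ℚ.+_) (lsum-map-scale c h h-scale p g))
      (solve 4 (λ c d x y → (c :* d) :* x :+ c :* y := c :* (d :* x :+ y)) refl c d (g w) (lsum p g))

  lsum-map-word : ∀ {W' : Set} (h : ℚ × W → ℚ × W') (f : W → W') → (∀ d w → h (d , w) ≡ (d , f w)) →
                  ∀ p g → lsum (map h p) g ≡ lsum p (λ w → g (f w))
  lsum-map-word h f h-word [] g = refl
  lsum-map-word h f h-word ((d , w) ∷ p) g rewrite h-word d w =
    cong (d ℚ.* g (f w) ℚ.+_) (lsum-map-word h f h-word p g)

  lsum-singleton : ∀ (w : W) g → lsum ((1ℚ , w) ∷ []) g ≡ g w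
  lsum-singleton w g = trans (QP.+-identityʳ _) (QP.*-identityˡ _)

  lsum-congʳ : ∀ (p : List (ℚ × W)) {g h} → (∀ w → g w ≡ h w) → lsum p g ≡ lsum p h
  lsum-congʳ [] g≗h = refl
  lsum-congʳ ((c , w) ∷ p) g≗h = cong₂ ℚ._+_ (cong (c ℚ.*_) (g≗h w)) (lsum-congʳ p g≗h)

  lsum-+ : ∀ (p : List (ℚ × W)) g h → lsum p (λ w → g w ℚ.+ h w) ≡ lsum p g ℚ.+ lsum p h
  lsum-+ [] g h = refl
  lsum-+ ((c , w) ∷ p) g h = trans (cong (c ℚ.* (g w ℚ.+ h w) ℚ.+_) (lsum-+ p g h))
    (solve 5 (λ c x y a b → c :* (x :+ y) :+ (a :+ b) := (c :* x :+ a) :+ (c :* y :+ b))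
       refl c (g w) (h w) (lsum p g) (lsum p h))

  lsum-* : ∀ (p : List (ℚ × W)) k g → lsum p (λ w → k ℚ.* g w) ≡ k ℚ.* lsum p g
  lsum-* [] k g = sym (QP.*-zeroʳ k)
  lsum-* ((c , w) ∷ p) k g = trans (cong (c ℚ.* (k ℚ.* g w) ℚ.+_) (lsum-* p k g))
    (solve 4 (λ c k x a → c :* (k :* x) :+ k :* a := k :* (c :* x :+ a)) refl c k (g w) (lsum p g))

  lsum-0 : ∀ (p : List (ℚ × W)) → lsum p (λ _ → 0ℚ) ≡ 0ℚ
  lsum-0 [] = refl
  lsum-0 ((c , w) ∷ p) = cong₂ ℚ._+_ (QP.*-zeroʳ c) (lsum-0 p)

lsum-comm : ∀ {W W' : Set} (p : List (ℚ × W)) (q : List (ℚ × W')) (G : W → W' → ℚ) →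
            lsum p (λ v → lsum q (λ w → G v w)) ≡ lsum q (λ w → lsum p (λ v → G v w))
lsum-comm [] q G = sym (lsum-0 q)
lsum-comm ((c , v) ∷ p) q G = sym (trans (lsum-+ q (λ w → c ℚ.* G v w) (λ w → lsum p (λ v → G v w)))
  (cong₂ ℚ._+_ (lsum-* q c (G v)) (sym (lsum-comm p q G))))

lsum-linExt : ∀ {W W' : Set} (f : W → List (ℚ × W')) p g →
              lsum (linExt f p) g ≡ lsum p (λ w → lsum (f w) g)
lsum-linExt f [] g = refl
lsum-linExt f ((c , w) ∷ p) g = trans (lsum-++ (map _ (f w)) (linExt f p) g)
  (cong₂ ℚ._+_ (lsum-map-scale c _ (λ _ _ → refl) (f w) g) (lsum-linExt f p g))

lsum-bilinExt : ∀ {W₁ W₂ W : Set} (f : W₁ → W₂ → List (ℚ × W)) p q g →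
                lsum (bilinExt f p q) g ≡ lsum p (λ v → lsum q (λ w → lsum (f v w) g))
lsum-bilinExt f p q g =
  trans (lsum-linExt (λ v → linExt (f v) q) p g) (lsum-congʳ p (λ v → lsum-linExt (f v) q g))

module Coefficients {W : Set} (_≟_ : DecidableEquality W) where
  open Lin _≟_

  indicator : W → W → ℚ
  indicator v = coeff ⟦ v ⟧

  indicator-≢ : ∀ {v w} → ¬ v ≡ w → indicator v w ≡ 0ℚ
  indicator-≢ {v} {w} v≢w with v ≟ w
  ... | yes v≡w = ⊥-elim (v≢w v≡w)
  ... | no _ = refl

  coeff-∷-≡ : ∀ c v p → coeff ((c , v) ∷ p) v ≡ c ℚ.+ coeff p v
  coeff-∷-≡ c v p with v ≟ v
  ... | yes _ = refl
  ... | no v≢v = ⊥-elim (v≢v refl)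

  coeff-∷-≢ : ∀ c {v w} p → ¬ v ≡ w → coeff ((c , v) ∷ p) w ≡ coeff p w
  coeff-∷-≢ c {v} {w} p v≢w with v ≟ w
  ... | yes v≡w = ⊥-elim (v≢w v≡w)
  ... | no _ = refl

  indicator-≡ : ∀ v → indicator v v ≡ 1ℚ
  indicator-≡ v with v ≟ v
  ... | yes _ = QP.+-identityʳ 1ℚ
  ... | no v≢v = ⊥-elim (v≢v refl)

  coeff≡lsum-indicator : ∀ p w → coeff p w ≡ lsum p (λ v → indicator v w)
  coeff≡lsum-indicator [] w = refl
  coeff≡lsum-indicator ((c , v) ∷ p) w = by-cases (v ≟ w)
    where
    by-cases : Dec (v ≡ w) → coeff ((c , v) ∷ p) w ≡ lsum ((c , v) ∷ p) (λ v → indicator v w)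
    by-cases (yes refl) = trans (coeff-∷-≡ c v p)
      (cong₂ ℚ._+_ (sym (trans (cong (c ℚ.*_) (indicator-≡ v)) (QP.*-identityʳ c))) (coeff≡lsum-indicator p v))
    by-cases (no v≢w) = trans (coeff-∷-≢ c p v≢w) (trans (coeff≡lsum-indicator p w)
      (sym (trans (cong (ℚ._+ _) (trans (cong (c ℚ.*_) (indicator-≢ v≢w)) (QP.*-zeroʳ c))) (QP.+-identityˡ _))))

  ≈-from-lsum : ∀ p q → (∀ g → lsum p g ≡ lsum q g) → p ≈ q
  ≈-from-lsum p q lsum-p≡lsum-q w =
    trans (coeff≡lsum-indicator p w) (trans (lsum-p≡lsum-q _) (sym (coeff≡lsum-indicator q w)))

  remove : W → List (ℚ × W) → List (ℚ × W)
  remove v [] = []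
  remove v ((c , w) ∷ p) with w ≟ v
  ... | yes _ = remove v p
  ... | no _ = (c , w) ∷ remove v p

  length-remove : ∀ v p → length (remove v p) ℕ.≤ length p
  length-remove v [] = z≤n
  length-remove v ((c , w) ∷ p) with w ≟ v
  ... | yes _ = NP.m≤n⇒m≤1+n (length-remove v p)
  ... | no _ = s≤s (length-remove v p)

  lsum-remove : ∀ v p g → lsum p g ≡ coeff p v ℚ.* g v ℚ.+ lsum (remove v p) g
  lsum-remove v [] g = sym (trans (QP.+-identityʳ _) (QP.*-zeroˡ (g v)))
  lsum-remove v ((c , w) ∷ p) g with w ≟ v
  ... | yes refl = trans (cong (c ℚ.* g w ℚ.+_) (lsum-remove w p g))
         (solve 4 (λ c x a b → c :* x :+ (a :* x :+ b) := (c :+ a) :* x :+ b)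
            refl c (g w) (coeff p w) (lsum (remove w p) g))
  ... | no _ = trans (cong (c ℚ.* g w ℚ.+_) (lsum-remove v p g))
         (solve 4 (λ y a x b → y :+ (a :* x :+ b) := a :* x :+ (y :+ b))
            refl (c ℚ.* g w) (coeff p v) (g v) (lsum (remove v p) g))

  coeff-remove-≡ : ∀ v p → coeff (remove v p) v ≡ 0ℚ
  coeff-remove-≡ v [] = refl
  coeff-remove-≡ v ((c , w) ∷ p) with w ≟ v
  ... | yes _ = coeff-remove-≡ v p
  ... | no w≢v = trans (coeff-∷-≢ c (remove v p) w≢v) (coeff-remove-≡ v p)

  coeff-∷-cong : ∀ c u {p q} w → coeff p w ≡ coeff q w → coeff ((c , u) ∷ p) w ≡ coeff ((c , u) ∷ q) w
  coeff-∷-cong c u w p≈q with u ≟ w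
  ... | yes _ = cong (c ℚ.+_) p≈q
  ... | no _ = p≈q

  coeff-remove-≢ : ∀ v p w → ¬ v ≡ w → coeff (remove v p) w ≡ coeff p w
  coeff-remove-≢ v [] w v≢w = refl
  coeff-remove-≢ v ((c , u) ∷ p) w v≢w with u ≟ v
  ... | yes refl = trans (coeff-remove-≢ v p w v≢w) (sym (coeff-∷-≢ c p v≢w))
  ... | no _ = coeff-∷-cong c u w (coeff-remove-≢ v p w v≢w)

  -- The bound m on the length makes the induction over repeated removal structural.
  lsum-vanishes : ∀ m p h → length p ℕ.≤ m → (∀ w → coeff p w ≡ 0ℚ ⊎ h w ≡ 0ℚ) → lsum p h ≡ 0ℚ
  lsum-vanishes m [] h _ _ = refl
  lsum-vanishes (suc m) ((c , v) ∷ p) h (s≤s |p|≤m) coeff⊎h = begin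
      c ℚ.* h v ℚ.+ lsum p h
    ≡⟨ cong (c ℚ.* h v ℚ.+_) (lsum-remove v p h) ⟩
      c ℚ.* h v ℚ.+ (coeff p v ℚ.* h v ℚ.+ lsum (remove v p) h)
    ≡⟨ solve 4 (λ c x a b → c :* x :+ (a :* x :+ b) := (c :+ a) :* x :+ b)
         refl c (h v) (coeff p v) (lsum (remove v p) h) ⟩
      (c ℚ.+ coeff p v) ℚ.* h v ℚ.+ lsum (remove v p) h
    ≡⟨ cong (λ x → x ℚ.* h v ℚ.+ lsum (remove v p) h) (sym (coeff-∷-≡ c v p)) ⟩
      coeff ((c , v) ∷ p) v ℚ.* h v ℚ.+ lsum (remove v p) h
    ≡⟨ cong (ℚ._+ lsum (remove v p) h) (product-vanishes (coeff⊎h v)) ⟩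
      0ℚ ℚ.+ lsum (remove v p) h
    ≡⟨ QP.+-identityˡ _ ⟩
      lsum (remove v p) h
    ≡⟨ lsum-vanishes m (remove v p) h (NP.≤-trans (length-remove v p) |p|≤m) coeff⊎h-removed ⟩
      0ℚ
    ∎
    where
    product-vanishes : ∀ {x y} → x ≡ 0ℚ ⊎ y ≡ 0ℚ → x ℚ.* y ≡ 0ℚ
    product-vanishes {y = y} (inj₁ refl) = QP.*-zeroˡ y
    product-vanishes {x = x} (inj₂ refl) = QP.*-zeroʳ x
    coeff⊎h-removed : ∀ w → coeff (remove v p) w ≡ 0ℚ ⊎ h w ≡ 0ℚ
    coeff⊎h-removed w with v ≟ w
    ... | yes refl = inj₁ (coeff-remove-≡ v p)
    ... | no v≢w with coeff⊎h w
    ...   | inj₁ e = inj₁ (trans (coeff-remove-≢ v p w v≢w) (trans (sym (coeff-∷-≢ c p v≢w)) e))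
    ...   | inj₂ e = inj₂ e

module ShiftLaws (n : ℕ) where
  open Alg n

  toℕ-⊞ : ∀ i j → toℕ (i ⊞ j) ≡ (toℕ i ℕ.+ toℕ j) % N
  toℕ-⊞ i j = FP.toℕ-fromℕ< _

  %-absorbˡ : ∀ m k → (m % N ℕ.+ k) % N ≡ (m ℕ.+ k) % N
  %-absorbˡ m k = begin
      (m % N ℕ.+ k) % N          ≡⟨ %-distribˡ-+ (m % N) k N ⟩
      (m % N % N ℕ.+ k % N) % N  ≡⟨ cong (λ r → (r ℕ.+ k % N) % N) (m%n%n≡m%n m N) ⟩
      (m % N ℕ.+ k % N) % N      ≡⟨ sym (%-distribˡ-+ m k N) ⟩
      (m ℕ.+ k) % N              ∎

  %-absorbʳ : ∀ m k → (k ℕ.+ m % N) % N ≡ (k ℕ.+ m) % N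
  %-absorbʳ m k = trans (cong (_% N) (NP.+-comm k (m % N)))
    (trans (%-absorbˡ m k) (cong (_% N) (NP.+-comm m k)))

  ⊞-assoc : ∀ i j k → (i ⊞ j) ⊞ k ≡ i ⊞ (j ⊞ k)
  ⊞-assoc i j k = FP.toℕ-injective (begin
      toℕ ((i ⊞ j) ⊞ k)                  ≡⟨ toℕ-⊞ (i ⊞ j) k ⟩
      (toℕ (i ⊞ j) ℕ.+ toℕ k) % N        ≡⟨ cong (λ r → (r ℕ.+ toℕ k) % N) (toℕ-⊞ i j) ⟩
      ((toℕ i ℕ.+ toℕ j) % N ℕ.+ toℕ k) % N ≡⟨ %-absorbˡ (toℕ i ℕ.+ toℕ j) (toℕ k) ⟩
      (toℕ i ℕ.+ toℕ j ℕ.+ toℕ k) % N    ≡⟨ cong (_% N) (NP.+-assoc (toℕ i) (toℕ j) (toℕ k)) ⟩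
      (toℕ i ℕ.+ (toℕ j ℕ.+ toℕ k)) % N  ≡⟨ sym (%-absorbʳ (toℕ j ℕ.+ toℕ k) (toℕ i)) ⟩
      (toℕ i ℕ.+ (toℕ j ℕ.+ toℕ k) % N) % N ≡⟨ cong (λ r → (toℕ i ℕ.+ r) % N) (sym (toℕ-⊞ j k)) ⟩
      (toℕ i ℕ.+ toℕ (j ⊞ k)) % N        ≡⟨ sym (toℕ-⊞ i (j ⊞ k)) ⟩
      toℕ (i ⊞ (j ⊞ k))                  ∎)

  ⊞-comm : ∀ i j → i ⊞ j ≡ j ⊞ i
  ⊞-comm i j = FP.toℕ-injective
    (trans (toℕ-⊞ i j) (trans (cong (_% N) (NP.+-comm (toℕ i) (toℕ j))) (sym (toℕ-⊞ j i))))

  ⊞-identityʳ : ∀ i → i ⊞ idx0 ≡ i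
  ⊞-identityʳ i = FP.toℕ-injective
    (trans (toℕ-⊞ i idx0) (trans (cong (_% N) (NP.+-identityʳ (toℕ i))) (m<n⇒m%n≡m (FP.toℕ<n i))))

  ⊞-identityˡ : ∀ i → idx0 ⊞ i ≡ i
  ⊞-identityˡ i = trans (⊞-comm idx0 i) (⊞-identityʳ i)

  ⊟-inverseˡ : ∀ j → (⊟ j) ⊞ j ≡ idx0
  ⊟-inverseˡ j = FP.toℕ-injective (begin
      toℕ ((⊟ j) ⊞ j)                          ≡⟨ toℕ-⊞ (⊟ j) j ⟩
      (toℕ (⊟ j) ℕ.+ toℕ j) % N
        ≡⟨ cong (λ r → (r ℕ.+ toℕ j) % N) (FP.toℕ-fromℕ< (m%n<n (N ℕ.∸ toℕ j) N)) ⟩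
      ((N ℕ.∸ toℕ j) % N ℕ.+ toℕ j) % N        ≡⟨ %-absorbˡ (N ℕ.∸ toℕ j) (toℕ j) ⟩
      (N ℕ.∸ toℕ j ℕ.+ toℕ j) % N              ≡⟨ cong (_% N) (NP.m∸n+n≡m (NP.<⇒≤ (FP.toℕ<n j))) ⟩
      N % N                                    ≡⟨ n%n≡0 N ⟩
      0                                        ∎)

  ⊟-inverseʳ : ∀ j → j ⊞ (⊟ j) ≡ idx0
  ⊟-inverseʳ j = trans (⊞-comm j (⊟ j)) (⊟-inverseˡ j)

  ⊞-cancelʳ : ∀ {i j} k → i ⊞ k ≡ j ⊞ k → i ≡ j
  ⊞-cancelʳ {i} {j} k i⊞k≡j⊞k = begin
      i                    ≡⟨ sym (⊞-identityʳ i) ⟩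
      i ⊞ idx0             ≡⟨ cong (i ⊞_) (sym (⊟-inverseʳ k)) ⟩
      i ⊞ (k ⊞ (⊟ k))      ≡⟨ sym (⊞-assoc i k (⊟ k)) ⟩
      (i ⊞ k) ⊞ (⊟ k)      ≡⟨ cong (_⊞ (⊟ k)) i⊞k≡j⊞k ⟩
      (j ⊞ k) ⊞ (⊟ k)      ≡⟨ ⊞-assoc j k (⊟ k) ⟩
      j ⊞ (k ⊞ (⊟ k))      ≡⟨ cong (j ⊞_) (⊟-inverseʳ k) ⟩
      j ⊞ idx0             ≡⟨ ⊞-identityʳ j ⟩
      j                    ∎

  ⊞-⊟-⊞ : ∀ j l → j ⊞ (⊟ (l ⊞ j)) ≡ ⊟ l
  ⊞-⊟-⊞ j l = ⊞-cancelʳ l (begin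
      (j ⊞ (⊟ (l ⊞ j))) ⊞ l  ≡⟨ cong (_⊞ l) (⊞-comm j (⊟ (l ⊞ j))) ⟩
      ((⊟ (l ⊞ j)) ⊞ j) ⊞ l  ≡⟨ ⊞-assoc (⊟ (l ⊞ j)) j l ⟩
      (⊟ (l ⊞ j)) ⊞ (j ⊞ l)  ≡⟨ cong ((⊟ (l ⊞ j)) ⊞_) (⊞-comm j l) ⟩
      (⊟ (l ⊞ j)) ⊞ (l ⊞ j)  ≡⟨ ⊟-inverseˡ (l ⊞ j) ⟩
      idx0                   ≡⟨ sym (⊟-inverseˡ l) ⟩
      (⊟ l) ⊞ l              ∎)

  τw-τw : ∀ i j w → τw i (τw j w) ≡ τw (j ⊞ i) w
  τw-τw i j [] = refl
  τw-τw i j ((k , l) ∷ w) = cong₂ _∷_ (cong (k ,_) (⊞-assoc l j i)) (τw-τw i j w)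

  τw-idx0 : ∀ w → τw idx0 w ≡ w
  τw-idx0 [] = refl
  τw-idx0 ((k , l) ∷ w) = cong₂ _∷_ (cong (k ,_) (⊞-identityʳ l)) (τw-idx0 w)

  τw-τw-⊟ : ∀ j w → τw j (τw (⊟ j) w) ≡ w
  τw-τw-⊟ j w = trans (τw-τw j (⊟ j) w) (trans (cong (λ i → τw i w) (⊟-inverseˡ j)) (τw-idx0 w))


module Derivation (n : ℕ) where
  open Alg n
  open ShiftLaws n

  lsum-τ : ∀ j p g → lsum (τ j p) g ≡ lsum p (λ w → g (τw j w))
  lsum-τ j p g =
    trans (lsum-linExt (λ w → A1.⟦ τw j w ⟧) p g) (lsum-congʳ p (λ w → lsum-singleton (τw j w) g))

  lsum-ycons : ∀ x p g → lsum (ycons x p) g ≡ lsum p (λ w → g (x ∷ w))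
  lsum-ycons x = lsum-map-word _ (x ∷_) (λ _ _ → refl)

  lsum-ycons-τ-singleton : ∀ x j w g → lsum (ycons x (τ j A1.⟦ w ⟧)) g ≡ g (x ∷ τw j w)
  lsum-ycons-τ-singleton x j w g = begin
      lsum (ycons x (τ j A1.⟦ w ⟧)) g       ≡⟨ lsum-ycons x (τ j A1.⟦ w ⟧) g ⟩
      lsum (τ j A1.⟦ w ⟧) (λ v → g (x ∷ v)) ≡⟨ lsum-τ j A1.⟦ w ⟧ (λ v → g (x ∷ v)) ⟩
      lsum A1.⟦ w ⟧ (λ v → g (x ∷ τw j v)) ≡⟨ lsum-singleton w (λ v → g (x ∷ τw j v)) ⟩
      g (x ∷ τw j w)                        ∎

  y₀ : ℕ → YLetter
  y₀ k = (k , idx0)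

  lsum-zElem : ∀ z g → lsum (zElem z) g ≡ lsum z (λ k → g (y₀ k ∷ []))
  lsum-zElem = lsum-map-word _ (λ k → y₀ k ∷ []) (λ _ _ → refl)

  lsum-· : ∀ u v g → lsum (u · v) g ≡ lsum u (λ α → lsum v (λ β → g (α ++ β)))
  lsum-· u v g = trans (lsum-bilinExt (λ α β → A1.⟦ α ++ β ⟧) u v g)
    (lsum-congʳ u (λ α → lsum-congʳ v (λ β → lsum-singleton (α ++ β) g)))

  δyPair : ℕ → YWord → (YWord → ℚ) → ℚ
  δyPair k w g = lsum (stuffleW (y₀ k ∷ []) w) g ℚ.+ ℚ.- 1ℚ ℚ.* g (y₀ k ∷ w)

  lsum-stuffle-y₀-∷ : ∀ k t l ω g → lsum (stuffleW (y₀ k ∷ []) ((t , l) ∷ ω)) g ≡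
    (g (y₀ k ∷ (t , l) ∷ ω) ℚ.+ lsum (stuffleW (y₀ k ∷ []) (τw (⊟ l) ω)) (λ v → g ((t , l) ∷ τw l v)))
      ℚ.+ g ((suc (k ℕ.+ t) , l) ∷ ω)
  lsum-stuffle-y₀-∷ k t l ω g = begin
      lsum (first ++ (middle ++ last)) g
    ≡⟨ lsum-++ first (middle ++ last) g ⟩
      lsum first g ℚ.+ lsum (middle ++ last) g
    ≡⟨ cong (lsum first g ℚ.+_) (lsum-++ middle last g) ⟩
      lsum first g ℚ.+ (lsum middle g ℚ.+ lsum last g)
    ≡⟨ sym (QP.+-assoc (lsum first g) (lsum middle g) (lsum last g)) ⟩
      (lsum first g ℚ.+ lsum middle g) ℚ.+ lsum last g
    ≡⟨ cong₂ ℚ._+_ (cong₂ ℚ._+_ first-term middle-term) last-term ⟩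
      (g (y₀ k ∷ (t , l) ∷ ω) ℚ.+ lsum (stuffleW (y₀ k ∷ []) (τw (⊟ l) ω)) (λ v → g ((t , l) ∷ τw l v)))
        ℚ.+ g ((suc (k ℕ.+ t) , l) ∷ ω)
    ∎
    where
    -- the fuel left for the recursive call is that of the original word, not of τw (⊟ l) ω
    inner : 𝔄¹
    inner = stF (suc (length ω)) (y₀ k ∷ []) (τw (⊟ l) ω)
    first middle last : 𝔄¹
    first = ycons (y₀ k) (τ idx0 A1.⟦ (t , l) ∷ ω ⟧)
    middle = ycons (t , l) (τ l inner)
    last = ycons (suc (k ℕ.+ t) , idx0 ⊞ l) (τ (idx0 ⊞ l) A1.⟦ τw (⊟ l) ω ⟧)
    first-term : lsum first g ≡ g (y₀ k ∷ (t , l) ∷ ω)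
    first-term = trans (lsum-ycons-τ-singleton (y₀ k) idx0 ((t , l) ∷ ω) g)
                       (cong (λ w → g (y₀ k ∷ w)) (τw-idx0 ((t , l) ∷ ω)))
    middle-term : lsum middle g ≡ lsum (stuffleW (y₀ k ∷ []) (τw (⊟ l) ω)) (λ v → g ((t , l) ∷ τw l v))
    middle-term = trans (lsum-ycons (t , l) (τ l inner) g) (trans (lsum-τ l inner _)
      (cong (λ m → lsum (stF (suc m) (y₀ k ∷ []) (τw (⊟ l) ω)) (λ v → g ((t , l) ∷ τw l v)))
            (sym (LP.length-map _ ω))))
    last-term : lsum last g ≡ g ((suc (k ℕ.+ t) , l) ∷ ω)
    last-term = trans (lsum-ycons-τ-singleton (suc (k ℕ.+ t) , idx0 ⊞ l) (idx0 ⊞ l) (τw (⊟ l) ω) g)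
      (trans (cong (λ j → g ((suc (k ℕ.+ t) , j) ∷ τw j (τw (⊟ l) ω))) (⊞-identityˡ l))
             (cong (λ w → g ((suc (k ℕ.+ t) , l) ∷ w)) (τw-τw-⊟ l ω)))

  δyPair-[] : ∀ k g → δyPair k [] g ≡ 0ℚ
  δyPair-[] k g = trans (cong (ℚ._+ ℚ.- 1ℚ ℚ.* g (y₀ k ∷ [])) (lsum-singleton (y₀ k ∷ []) g))
    (solve 1 (λ x → x :+ (:- con 1ℚ) :* x := con 0ℚ) refl (g (y₀ k ∷ [])))

  δyPair-unfold : ∀ k t l ω g → δyPair k ((t , l) ∷ ω) g ≡
    lsum (stuffleW (y₀ k ∷ []) (τw (⊟ l) ω)) (λ v → g ((t , l) ∷ τw l v)) ℚ.+ g ((suc (k ℕ.+ t) , l) ∷ ω)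
  δyPair-unfold k t l ω g =
    trans (cong (ℚ._+ ℚ.- 1ℚ ℚ.* g (y₀ k ∷ (t , l) ∷ ω)) (lsum-stuffle-y₀-∷ k t l ω g))
      (solve 3 (λ x y z → ((x :+ y) :+ z) :+ (:- con 1ℚ) :* x := y :+ z) refl
         (g (y₀ k ∷ (t , l) ∷ ω)) (lsum (stuffleW (y₀ k ∷ []) (τw (⊟ l) ω)) (λ v → g ((t , l) ∷ τw l v)))
         (g ((suc (k ℕ.+ t) , l) ∷ ω)))

  δyPair-congʳ : ∀ k w {g h} → (∀ v → g v ≡ h v) → δyPair k w g ≡ δyPair k w h
  δyPair-congʳ k w g≗h =
    cong₂ ℚ._+_ (lsum-congʳ (stuffleW (y₀ k ∷ []) w) g≗h) (cong (ℚ.- 1ℚ ℚ.*_) (g≗h (y₀ k ∷ w)))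

  δyPair-τw : ∀ k w j g → δyPair k (τw j w) g ≡ δyPair k w (λ v → g (τw j v))
  δyPair-τw k [] j g = trans (δyPair-[] k g) (sym (δyPair-[] k (λ v → g (τw j v))))
  δyPair-τw k ((t , l) ∷ ω) j g = begin
      δyPair k ((t , l ⊞ j) ∷ τw j ω) g
    ≡⟨ δyPair-unfold k t (l ⊞ j) (τw j ω) g ⟩
      lsum (stuffleW (y₀ k ∷ []) (τw (⊟ (l ⊞ j)) (τw j ω))) (λ v → g ((t , l ⊞ j) ∷ τw (l ⊞ j) v)) ℚ.+ last
    ≡⟨ cong (λ w → lsum (stuffleW (y₀ k ∷ []) w) (λ v → g ((t , l ⊞ j) ∷ τw (l ⊞ j) v)) ℚ.+ last)
         (trans (τw-τw (⊟ (l ⊞ j)) j ω) (cong (λ i → τw i ω) (⊞-⊟-⊞ j l))) ⟩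
      lsum (stuffleW (y₀ k ∷ []) (τw (⊟ l) ω)) (λ v → g ((t , l ⊞ j) ∷ τw (l ⊞ j) v)) ℚ.+ last
    ≡⟨ cong (ℚ._+ last) (lsum-congʳ (stuffleW (y₀ k ∷ []) (τw (⊟ l) ω))
         (λ v → cong (λ w → g ((t , l ⊞ j) ∷ w)) (sym (τw-τw j l v)))) ⟩
      lsum (stuffleW (y₀ k ∷ []) (τw (⊟ l) ω)) (λ v → g (τw j ((t , l) ∷ τw l v))) ℚ.+ last
    ≡⟨ sym (δyPair-unfold k t l ω (λ v → g (τw j v))) ⟩
      δyPair k ((t , l) ∷ ω) (λ v → g (τw j v))
    ∎
    where
    last : ℚ
    last = g ((suc (k ℕ.+ t) , l ⊞ j) ∷ τw j ω)

  δyPair-∷ : ∀ k t l ω g → δyPair k ((t , l) ∷ ω) g ≡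
    (g ((t , l) ∷ (k , l) ∷ ω) ℚ.+ δyPair k ω (λ v → g ((t , l) ∷ v))) ℚ.+ g ((suc (k ℕ.+ t) , l) ∷ ω)
  δyPair-∷ k t l ω g = trans (δyPair-unfold k t l ω g) (cong (ℚ._+ g ((suc (k ℕ.+ t) , l) ∷ ω)) (begin
      lsum (stuffleW (y₀ k ∷ []) ω') g'
    ≡⟨ solve 2 (λ s x → s := (s :+ (:- con 1ℚ) :* x) :+ x) refl
         (lsum (stuffleW (y₀ k ∷ []) ω') g') (g' (y₀ k ∷ ω')) ⟩
      δyPair k ω' g' ℚ.+ g' (y₀ k ∷ ω')
    ≡⟨ cong₂ ℚ._+_ (δyPair-τw k ω (⊟ l) g')
                   (cong₂ (λ i w → g ((t , l) ∷ (k , i) ∷ w)) (⊞-identityˡ l) (τw-τw-⊟ l ω)) ⟩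
      δyPair k ω (λ v → g' (τw (⊟ l) v)) ℚ.+ g ((t , l) ∷ (k , l) ∷ ω)
    ≡⟨ cong (ℚ._+ g ((t , l) ∷ (k , l) ∷ ω))
         (δyPair-congʳ k ω (λ v → cong (λ w → g ((t , l) ∷ w)) (τw-τw-⊟ l v))) ⟩
      δyPair k ω (λ v → g ((t , l) ∷ v)) ℚ.+ g ((t , l) ∷ (k , l) ∷ ω)
    ≡⟨ QP.+-comm (δyPair k ω (λ v → g ((t , l) ∷ v))) (g ((t , l) ∷ (k , l) ∷ ω)) ⟩
      g ((t , l) ∷ (k , l) ∷ ω) ℚ.+ δyPair k ω (λ v → g ((t , l) ∷ v))
    ∎))
    where
    ω' : YWord
    ω' = τw (⊟ l) ω
    g' : YWord → ℚ
    g' v = g ((t , l) ∷ τw l v)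

  δyPair-++ : ∀ k u v g → δyPair k (u ++ v) g ≡ δyPair k u (λ x → g (x ++ v)) ℚ.+ δyPair k v (λ x → g (u ++ x))
  δyPair-++ k [] v g = sym (trans (cong (ℚ._+ δyPair k v g) (δyPair-[] k (λ x → g (x ++ v)))) (QP.+-identityˡ _))
  δyPair-++ k ((t , l) ∷ u) v g = begin
      δyPair k ((t , l) ∷ u ++ v) g
    ≡⟨ δyPair-∷ k t l (u ++ v) g ⟩
      (twice ℚ.+ δyPair k (u ++ v) (λ x → g ((t , l) ∷ x))) ℚ.+ merged
    ≡⟨ cong (λ m → (twice ℚ.+ m) ℚ.+ merged) (δyPair-++ k u v (λ x → g ((t , l) ∷ x))) ⟩
      (twice ℚ.+ (left ℚ.+ right)) ℚ.+ merged
    ≡⟨ solve 4 (λ p x y q → (p :+ (x :+ y)) :+ q := ((p :+ x) :+ q) :+ y) refl twice left right merged ⟩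
      ((twice ℚ.+ left) ℚ.+ merged) ℚ.+ right
    ≡⟨ cong (ℚ._+ right) (sym (δyPair-∷ k t l u (λ x → g (x ++ v)))) ⟩
      δyPair k ((t , l) ∷ u) (λ x → g (x ++ v)) ℚ.+ right
    ∎
    where
    twice merged left right : ℚ
    twice = g ((t , l) ∷ (k , l) ∷ (u ++ v))
    merged = g ((suc (k ℕ.+ t) , l) ∷ (u ++ v))
    left = δyPair k u (λ x → g ((t , l) ∷ (x ++ v)))
    right = δyPair k v (λ x → g ((t , l) ∷ (u ++ x)))

  δyPair-0 : ∀ k w → δyPair k w (λ _ → 0ℚ) ≡ 0ℚ
  δyPair-0 k w = cong (ℚ._+ ℚ.- 1ℚ ℚ.* 0ℚ) (lsum-0 (stuffleW (y₀ k ∷ []) w))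

  δyPair-lsum : ∀ {W : Set} k w (q : List (ℚ × W)) (G : YWord → W → ℚ) →
    δyPair k w (λ x → lsum q (G x)) ≡ lsum q (λ β → δyPair k w (λ x → G x β))
  δyPair-lsum k w q G =
    trans (cong₂ ℚ._+_ (lsum-comm (stuffleW (y₀ k ∷ []) w) q G) (sym (lsum-* q (ℚ.- 1ℚ) (G (y₀ k ∷ w)))))
      (sym (lsum-+ q (λ β → lsum (stuffleW (y₀ k ∷ []) w) (λ x → G x β))
                     (λ β → ℚ.- 1ℚ ℚ.* G (y₀ k ∷ w) β)))

  δPair : 𝔷 → YWord → (YWord → ℚ) → ℚ
  δPair z w g = lsum z (λ k → δyPair k w g)

  δPair-congʳ : ∀ z w {g h} → (∀ v → g v ≡ h v) → δPair z w g ≡ δPair z w h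
  δPair-congʳ z w g≗h = lsum-congʳ z (λ k → δyPair-congʳ k w g≗h)

  δPair-++ : ∀ z u v g → δPair z (u ++ v) g ≡ δPair z u (λ x → g (x ++ v)) ℚ.+ δPair z v (λ x → g (u ++ x))
  δPair-++ z u v g = trans (lsum-congʳ z (λ k → δyPair-++ k u v g)) (lsum-+ z _ _)

  δPair-lsum : ∀ {W : Set} z w (q : List (ℚ × W)) (G : YWord → W → ℚ) →
    δPair z w (λ x → lsum q (G x)) ≡ lsum q (λ β → δPair z w (λ x → G x β))
  δPair-lsum z w q G =
    trans (lsum-congʳ z (λ k → δyPair-lsum k w q G)) (lsum-comm z q (λ k β → δyPair k w (λ x → G x β)))

  lsum-δ : ∀ z u g → lsum (δ z u) g ≡ lsum u (λ w → δPair z w g)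
  lsum-δ z u g = begin
      lsum (zElem z * u A1.⊕ A1.⊖ (zElem z · u)) g
    ≡⟨ lsum-++ (zElem z * u) (A1.⊖ (zElem z · u)) g ⟩
      lsum (zElem z * u) g ℚ.+ lsum (A1.⊖ (zElem z · u)) g
    ≡⟨ cong₂ ℚ._+_ stuffle-part (lsum-map-scale (ℚ.- 1ℚ) _ (λ _ _ → refl) (zElem z · u) g) ⟩
      lsum z S ℚ.+ ℚ.- 1ℚ ℚ.* lsum (zElem z · u) g
    ≡⟨ cong (λ x → lsum z S ℚ.+ ℚ.- 1ℚ ℚ.* x) (trans (lsum-· (zElem z) u g) (lsum-zElem z _)) ⟩
      lsum z S ℚ.+ ℚ.- 1ℚ ℚ.* lsum z C
    ≡⟨ cong (lsum z S ℚ.+_) (sym (lsum-* z (ℚ.- 1ℚ) C)) ⟩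
      lsum z S ℚ.+ lsum z (λ k → ℚ.- 1ℚ ℚ.* C k)
    ≡⟨ sym (lsum-+ z S (λ k → ℚ.- 1ℚ ℚ.* C k)) ⟩
      lsum z (λ k → S k ℚ.+ ℚ.- 1ℚ ℚ.* C k)
    ≡⟨ lsum-congʳ z per-letter ⟩
      lsum z (λ k → lsum u (λ w → δyPair k w g))
    ≡⟨ lsum-comm z u (λ k w → δyPair k w g) ⟩
      lsum u (λ w → δPair z w g)
    ∎
    where
    S C : ℕ → ℚ
    S k = lsum u (λ w → lsum (stuffleW (y₀ k ∷ []) w) g)
    C k = lsum u (λ w → g (y₀ k ∷ w))
    stuffle-part : lsum (zElem z * u) g ≡ lsum z S
    stuffle-part = trans (lsum-bilinExt stuffleW (zElem z) u g) (lsum-zElem z _)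
    per-letter : ∀ k → S k ℚ.+ ℚ.- 1ℚ ℚ.* C k ≡ lsum u (λ w → δyPair k w g)
    per-letter k = sym (trans
      (lsum-+ u (λ w → lsum (stuffleW (y₀ k ∷ []) w) g) (λ w → ℚ.- 1ℚ ℚ.* g (y₀ k ∷ w)))
      (cong (S k ℚ.+_) (lsum-* u (ℚ.- 1ℚ) (λ w → g (y₀ k ∷ w)))))

  open Coefficients _≟Y_

  δ-⊕ : ∀ z u v → δ z (u A1.⊕ v) A1.≈ (δ z u A1.⊕ δ z v)
  δ-⊕ z u v = ≈-from-lsum (δ z (u A1.⊕ v)) (δ z u A1.⊕ δ z v) same-pairings
    where
    same-pairings : ∀ g → lsum (δ z (u A1.⊕ v)) g ≡ lsum (δ z u A1.⊕ δ z v) g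
    same-pairings g = begin
        lsum (δ z (u ++ v)) g                       ≡⟨ lsum-δ z (u ++ v) g ⟩
        lsum (u ++ v) (λ w → δPair z w g)           ≡⟨ lsum-++ u v _ ⟩
        lsum u (λ w → δPair z w g) ℚ.+ lsum v (λ w → δPair z w g)
                                                    ≡⟨ sym (cong₂ ℚ._+_ (lsum-δ z u g) (lsum-δ z v g)) ⟩
        lsum (δ z u) g ℚ.+ lsum (δ z v) g           ≡⟨ sym (lsum-++ (δ z u) (δ z v) g) ⟩
        lsum (δ z u ++ δ z v) g                     ∎

  δ-● : ∀ z c u → δ z (c A1.● u) A1.≈ (c A1.● δ z u)
  δ-● z c u = ≈-from-lsum (δ z (c A1.● u)) (c A1.● δ z u) same-pairings
    where
    same-pairings : ∀ g → lsum (δ z (c A1.● u)) g ≡ lsum (c A1.● δ z u) g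
    same-pairings g = begin
        lsum (δ z (c A1.● u)) g                  ≡⟨ lsum-δ z (c A1.● u) g ⟩
        lsum (c A1.● u) (λ w → δPair z w g)      ≡⟨ lsum-map-scale c _ (λ _ _ → refl) u _ ⟩
        c ℚ.* lsum u (λ w → δPair z w g)         ≡⟨ cong (c ℚ.*_) (sym (lsum-δ z u g)) ⟩
        c ℚ.* lsum (δ z u) g                     ≡⟨ sym (lsum-map-scale c _ (λ _ _ → refl) (δ z u) g) ⟩
        lsum (c A1.● δ z u) g                    ∎

  δ-leibniz : ∀ z u v → δ z (u · v) A1.≈ ((δ z u · v) A1.⊕ (u · δ z v))
  δ-leibniz z u v = ≈-from-lsum (δ z (u · v)) ((δ z u · v) A1.⊕ (u · δ z v)) same-pairings
    where
    same-pairings : ∀ g → lsum (δ z (u · v)) g ≡ lsum ((δ z u · v) A1.⊕ (u · δ z v)) g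
    same-pairings g = begin
        lsum (δ z (u · v)) g
      ≡⟨ lsum-δ z (u · v) g ⟩
        lsum (u · v) (λ x → δPair z x g)
      ≡⟨ lsum-· u v (λ x → δPair z x g) ⟩
        lsum u (λ α → lsum v (λ β → δPair z (α ++ β) g))
      ≡⟨ lsum-congʳ u (λ α → trans (lsum-congʳ v (λ β → δPair-++ z α β g)) (lsum-+ v _ _)) ⟩
        lsum u (λ α → lsum v (λ β → δPair z α (λ x → g (x ++ β)))
                        ℚ.+ lsum v (λ β → δPair z β (λ x → g (α ++ x))))
      ≡⟨ lsum-+ u _ _ ⟩
        lsum u (λ α → lsum v (λ β → δPair z α (λ x → g (x ++ β))))
          ℚ.+ lsum u (λ α → lsum v (λ β → δPair z β (λ x → g (α ++ x))))
      ≡⟨ sym (cong₂ ℚ._+_ left-factor right-factor) ⟩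
        lsum (δ z u · v) g ℚ.+ lsum (u · δ z v) g
      ≡⟨ sym (lsum-++ (δ z u · v) (u · δ z v) g) ⟩
        lsum ((δ z u · v) A1.⊕ (u · δ z v)) g
      ∎
      where
      left-factor : lsum (δ z u · v) g ≡ lsum u (λ α → lsum v (λ β → δPair z α (λ x → g (x ++ β))))
      left-factor = trans (lsum-· (δ z u) v g) (trans (lsum-δ z u _)
        (lsum-congʳ u (λ α → δPair-lsum z α v (λ x β → g (x ++ β)))))
      right-factor : lsum (u · δ z v) g ≡ lsum u (λ α → lsum v (λ β → δPair z β (λ x → g (α ++ x))))
      right-factor = trans (lsum-· u (δ z v) g) (lsum-congʳ u (λ α → lsum-δ z v (λ β → g (α ++ β))))

  isA0Word? : ∀ w → Dec (IsA0Word w)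
  isA0Word? [] = yes tt
  isA0Word? ((k , i) ∷ _) with k NP.≟ 0 | i FP.≟ idx0
  ... | yes k≡0 | yes i≡0 = no (λ notB₀ → notB₀ (k≡0 , i≡0))
  ... | no k≢0 | _ = yes (λ k,i≡0 → k≢0 (proj₁ k,i≡0))
  ... | yes _ | no i≢0 = yes (λ k,i≡0 → i≢0 (proj₂ k,i≡0))

  -- Membership in 𝔄⁰ depends only on the first letter, which δ keeps or replaces by y_{s+t,l}, s + t ≥ 2.
  δyPair-𝔄⁰ : ∀ k w g → IsA0Word w → (∀ x → IsA0Word x → g x ≡ 0ℚ) → δyPair k w g ≡ 0ℚ
  δyPair-𝔄⁰ k [] g _ _ = δyPair-[] k g
  δyPair-𝔄⁰ k ((t , l) ∷ ω) g w∈𝔄⁰ g-kills-𝔄⁰ = begin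
      δyPair k ((t , l) ∷ ω) g
    ≡⟨ δyPair-∷ k t l ω g ⟩
      (g ((t , l) ∷ (k , l) ∷ ω) ℚ.+ δyPair k ω (λ v → g ((t , l) ∷ v))) ℚ.+ g ((suc (k ℕ.+ t) , l) ∷ ω)
    ≡⟨ cong₂ ℚ._+_ (cong₂ ℚ._+_ (g-kills-𝔄⁰ _ w∈𝔄⁰) tail-term)
                   (g-kills-𝔄⁰ _ (λ suc≡0 → NP.0≢1+n (sym (proj₁ suc≡0)))) ⟩
      0ℚ
    ∎
    where
    tail-term : δyPair k ω (λ v → g ((t , l) ∷ v)) ≡ 0ℚ
    tail-term = trans (δyPair-congʳ k ω (λ v → g-kills-𝔄⁰ ((t , l) ∷ v) w∈𝔄⁰)) (δyPair-0 k ω)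

  δ-preserves-𝔄⁰ : ∀ z u → InA0 u → InA0 (δ z u)
  δ-preserves-𝔄⁰ z u u∈𝔄⁰ v v∉𝔄⁰ =
    trans (coeff≡lsum-indicator (δ z u) v) (trans (lsum-δ z u (λ x → indicator x v))
      (lsum-vanishes (length u) u _ NP.≤-refl coeff⊎δPair))
    where
    indicator-kills-𝔄⁰ : ∀ x → IsA0Word x → indicator x v ≡ 0ℚ
    indicator-kills-𝔄⁰ x x∈𝔄⁰ = indicator-≢ (λ x≡v → v∉𝔄⁰ (subst IsA0Word x≡v x∈𝔄⁰))
    coeff⊎δPair : ∀ w → A1.coeff u w ≡ 0ℚ ⊎ δPair z w (λ x → indicator x v) ≡ 0ℚ
    coeff⊎δPair w with isA0Word? w
    ... | yes w∈𝔄⁰ =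
      inj₂ (trans (lsum-congʳ z (λ k → δyPair-𝔄⁰ k w _ w∈𝔄⁰ indicator-kills-𝔄⁰)) (lsum-0 z))
    ... | no w∉𝔄⁰ = inj₁ (u∈𝔄⁰ w w∉𝔄⁰)

module ExtensionTo𝔄 (n : ℕ) where
  open Alg n
  open ShiftLaws n
  open Derivation n

  aⁿ : ℕ → Word
  aⁿ t = replicate t a

  aⁿ-++-a∷ : ∀ t X → aⁿ t ++ a ∷ X ≡ a ∷ aⁿ t ++ X
  aⁿ-++-a∷ zero X = refl
  aⁿ-++-a∷ (suc t) X = cong (a ∷_) (aⁿ-++-a∷ t X)

  aⁿ-+-++ : ∀ t k X → aⁿ (t ℕ.+ k) ++ X ≡ aⁿ t ++ aⁿ k ++ X
  aⁿ-+-++ zero k X = refl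
  aⁿ-+-++ (suc t) k X = cong (a ∷_) (aⁿ-+-++ t k X)

  aⁿ-++-a∷-aⁿ : ∀ t k X → aⁿ t ++ a ∷ aⁿ k ++ X ≡ aⁿ (suc (k ℕ.+ t)) ++ X
  aⁿ-++-a∷-aⁿ t k X = trans (aⁿ-++-a∷ t (aⁿ k ++ X))
    (cong (a ∷_) (trans (sym (aⁿ-+-++ t k X)) (cong (λ m → aⁿ m ++ X) (NP.+-comm t k))))

  toWord-∷ : ∀ t l ω → toWord ((t , l) ∷ ω) ≡ aⁿ t ++ b l ∷ toWord ω
  toWord-∷ t l ω = LP.++-assoc (aⁿ t) (b l ∷ []) (toWord ω)

  lsum-·A : ∀ X Y g → lsum (X ·A Y) g ≡ lsum X (λ α → lsum Y (λ β → g (α ++ β)))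
  lsum-·A X Y g = trans (lsum-bilinExt (λ α β → A.⟦ α ++ β ⟧) X Y g)
    (lsum-congʳ X (λ α → lsum-congʳ Y (λ β → lsum-singleton (α ++ β) g)))

  lsum-⟦⟧·A : ∀ p X g → lsum (A.⟦ p ⟧ ·A X) g ≡ lsum X (λ β → g (p ++ β))
  lsum-⟦⟧·A p X g = trans (lsum-·A A.⟦ p ⟧ X g) (lsum-singleton p (λ α → lsum X (λ β → g (α ++ β))))

  lsum-·A⟦⟧ : ∀ q X g → lsum (X ·A A.⟦ q ⟧) g ≡ lsum X (λ α → g (α ++ q))
  lsum-·A⟦⟧ q X g = trans (lsum-·A X A.⟦ q ⟧ g) (lsum-congʳ X (λ α → lsum-singleton q (λ β → g (α ++ β))))

  lsum-embed : ∀ P g → lsum (embed P) g ≡ lsum P (λ v → g (toWord v))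
  lsum-embed P g =
    trans (lsum-linExt (λ w → A.⟦ toWord w ⟧) P g) (lsum-congʳ P (λ v → lsum-singleton (toWord v) g))

  lsum-Dword-aⁿ : ∀ z t w g → lsum (Dword z (aⁿ t ++ w)) g ≡ lsum (Dword z w) (λ x → g (aⁿ t ++ x))
  lsum-Dword-aⁿ z zero w g = refl
  lsum-Dword-aⁿ z (suc t) w g =
    trans (lsum-⟦⟧·A (a ∷ []) (Dword z (aⁿ t ++ w)) g) (lsum-Dword-aⁿ z t w (λ x → g (a ∷ x)))

  lsum-Dletter-b : ∀ z l h → lsum (Dletter z (b l)) h ≡
    lsum z (λ k → h (a ∷ aⁿ k ++ b l ∷ [])) ℚ.+ lsum z (λ k → h (b l ∷ aⁿ k ++ b l ∷ []))
  lsum-Dletter-b z l h = trans (lsum-·A a+bₗ τₗz h)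
    (cong₂ ℚ._+_ (trans (QP.*-identityˡ _) (lsum-τₗz (a ∷ [])))
                 (trans (QP.+-identityʳ _) (trans (QP.*-identityˡ _) (lsum-τₗz (b l ∷ [])))))
    where
    a+bₗ τₗz : 𝔄
    a+bₗ = (1ℚ , a ∷ []) ∷ (1ℚ , b l ∷ []) ∷ []
    τₗz = embed (τ l (zElem z))
    lsum-τₗz : ∀ p → lsum τₗz (λ β → h (p ++ β)) ≡ lsum z (λ k → h (p ++ aⁿ k ++ b l ∷ []))
    lsum-τₗz p = trans (lsum-embed (τ l (zElem z)) _) (trans (lsum-τ l (zElem z) _) (trans (lsum-zElem z _)
      (lsum-congʳ z (λ k → trans (cong (λ i → h (p ++ toWord ((k , i) ∷ []))) (⊞-identityˡ l))
                                 (cong (λ x → h (p ++ x)) (toWord-∷ k l []))))))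

  lsum-Dword-b∷ : ∀ z l W g → lsum (Dword z (b l ∷ W)) g ≡
    (lsum z (λ k → g (a ∷ aⁿ k ++ b l ∷ W)) ℚ.+ lsum z (λ k → g (b l ∷ aⁿ k ++ b l ∷ W)))
      ℚ.+ lsum (Dword z W) (λ x → g (b l ∷ x))
  lsum-Dword-b∷ z l W g = trans (lsum-++ (Dletter z (b l) ·A A.⟦ W ⟧) (A.⟦ b l ∷ [] ⟧ ·A Dword z W) g)
    (cong₂ ℚ._+_ letter-term (lsum-⟦⟧·A (b l ∷ []) (Dword z W) g))
    where
    reassoc : ∀ c k → g ((c ∷ aⁿ k ++ b l ∷ []) ++ W) ≡ g (c ∷ aⁿ k ++ b l ∷ W)
    reassoc c k = cong (λ x → g (c ∷ x)) (LP.++-assoc (aⁿ k) (b l ∷ []) W)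
    letter-term : lsum (Dletter z (b l) ·A A.⟦ W ⟧) g ≡
      lsum z (λ k → g (a ∷ aⁿ k ++ b l ∷ W)) ℚ.+ lsum z (λ k → g (b l ∷ aⁿ k ++ b l ∷ W))
    letter-term = trans (lsum-·A⟦⟧ W (Dletter z (b l)) g) (trans (lsum-Dletter-b z l (λ α → g (α ++ W)))
      (cong₂ ℚ._+_ (lsum-congʳ z (reassoc a)) (lsum-congʳ z (reassoc (b l)))))

  lsum-Dword-toWord : ∀ z β g → lsum (Dword z (toWord β)) g ≡ δPair z β (λ v → g (toWord v))
  lsum-Dword-toWord z [] g = sym (trans (lsum-congʳ z (λ k → δyPair-[] k (λ v → g (toWord v)))) (lsum-0 z))
  lsum-Dword-toWord z ((t , l) ∷ ω) g = begin
      lsum (Dword z (toWord ((t , l) ∷ ω))) g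
    ≡⟨ cong (λ x → lsum (Dword z x) g) (toWord-∷ t l ω) ⟩
      lsum (Dword z (aⁿ t ++ b l ∷ W)) g
    ≡⟨ lsum-Dword-aⁿ z t (b l ∷ W) g ⟩
      lsum (Dword z (b l ∷ W)) gₜ
    ≡⟨ lsum-Dword-b∷ z l W gₜ ⟩
      (lsum z (λ k → gₜ (a ∷ aⁿ k ++ b l ∷ W)) ℚ.+ lsum z (λ k → gₜ (b l ∷ aⁿ k ++ b l ∷ W)))
        ℚ.+ lsum (Dword z W) (λ x → gₜ (b l ∷ x))
    ≡⟨ cong₂ ℚ._+_ (cong₂ ℚ._+_ (lsum-congʳ z merged-word) (lsum-congʳ z twice-word))
         (trans (lsum-Dword-toWord z ω _) (δPair-congʳ z ω (λ v → cong g (sym (toWord-∷ t l v))))) ⟩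
      (lsum z merged ℚ.+ lsum z twice) ℚ.+ lsum z rest
    ≡⟨ solve 3 (λ x y m → (x :+ y) :+ m := (y :+ m) :+ x) refl (lsum z merged) (lsum z twice) (lsum z rest) ⟩
      (lsum z twice ℚ.+ lsum z rest) ℚ.+ lsum z merged
    ≡⟨ sym (trans (lsum-+ z _ merged) (cong (ℚ._+ lsum z merged) (lsum-+ z twice rest))) ⟩
      lsum z (λ k → (twice k ℚ.+ rest k) ℚ.+ merged k)
    ≡⟨ sym (lsum-congʳ z (λ k → δyPair-∷ k t l ω G)) ⟩
      δPair z ((t , l) ∷ ω) G
    ∎
    where
    W : Word
    W = toWord ω
    G : YWord → ℚ
    G v = g (toWord v)
    gₜ : Word → ℚ
    gₜ x = g (aⁿ t ++ x)
    twice rest merged : ℕ → ℚ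
    twice k = G ((t , l) ∷ (k , l) ∷ ω)
    rest k = δyPair k ω (λ v → G ((t , l) ∷ v))
    merged k = G ((suc (k ℕ.+ t) , l) ∷ ω)
    merged-word : ∀ k → gₜ (a ∷ aⁿ k ++ b l ∷ W) ≡ merged k
    merged-word k = cong g (trans (aⁿ-++-a∷-aⁿ t k (b l ∷ W)) (sym (toWord-∷ (suc (k ℕ.+ t)) l ω)))
    twice-word : ∀ k → gₜ (b l ∷ aⁿ k ++ b l ∷ W) ≡ twice k
    twice-word k = cong g (sym (trans (toWord-∷ t l ((k , l) ∷ ω))
                                      (cong (λ x → aⁿ t ++ b l ∷ x) (toWord-∷ k l ω))))

  embed-δ≈D : ∀ z u → embed (δ z u) A.≈ D z (embed u)
  embed-δ≈D z u = Coefficients.≈-from-lsum _≟W_ (embed (δ z u)) (D z (embed u)) same-pairings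
    where
    same-pairings : ∀ g → lsum (embed (δ z u)) g ≡ lsum (D z (embed u)) g
    same-pairings g = begin
        lsum (embed (δ z u)) g                          ≡⟨ lsum-embed (δ z u) g ⟩
        lsum (δ z u) (λ v → g (toWord v))               ≡⟨ lsum-δ z u _ ⟩
        lsum u (λ β → δPair z β (λ v → g (toWord v)))
                                                        ≡⟨ sym (lsum-congʳ u (λ β → lsum-Dword-toWord z β g)) ⟩
        lsum u (λ β → lsum (Dword z (toWord β)) g)      ≡⟨ sym (lsum-embed u _) ⟩
        lsum (embed u) (λ x → lsum (Dword z x) g)       ≡⟨ sym (lsum-linExt (Dword z) (embed u) g) ⟩
        lsum (D z (embed u)) g                          ∎

mainTheorem8 : (n : ℕ) → (z : Alg.𝔷 n) →
    let open Alg n in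
    -- δ_z is linear on 𝔄¹
    ((u v : 𝔄¹) → δ z (u A1.⊕ v) A1.≈ (δ z u A1.⊕ δ z v))
    × ((c : ℚ) (u : 𝔄¹) → δ z (c A1.● u) A1.≈ (c A1.● δ z u))
    -- Leibniz rule for concatenation on 𝔄¹
    × ((u v : 𝔄¹) → δ z (u · v) A1.≈ ((δ z u · v) A1.⊕ (u · δ z v)))
    -- δ_z preserves 𝔄⁰
    × ((u : 𝔄¹) → InA0 u → InA0 (δ z u))
    -- δ_z is the restriction of the derivation D_z of 𝔄
    × ((u : 𝔄¹) → embed (δ z u) A.≈ D z (embed u))
mainTheorem8 n z = δ-⊕ z , δ-● z , δ-leibniz z , δ-preserves-𝔄⁰ z , embed-δ≈D z
  where
  open Derivation n
  open ExtensionTo𝔄 n
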